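{- Let $n\ge1$ and let $T$ be a finite $n$-spindly tree. Then $T$ is the union of finitely many pairwise edge-disjoint paths $p_0,p_1,\dots,p_m$, each of length at least $n$, such that the sequence $p_0,p_1,\dots,p_m$ is end-ordered.
   Context: A tree is a connected acyclic graph; a leaf is a vertex of degree $1$. A tree $T$ is $n$-spindly if there is at most one distinguished leaf $l$ such that for all distinct leaves $x,y$ of $T$: if $l\notin\{x,y\}$ then $d(x,y)>2n$, and if $l\in\{x,y\}$ then $d(x,y)\ge n$ (here $d$ is graph distance; if there is no distinguished leaf, all pairs of distinct leaves have distance $>2n$). A sequence of subgraphs $H_0,H_1,\dots$ is end-ordered if whenever a vertex $x$ lies in $H_i$ and $H_j$ with $i<j$, $x$ is a leaf of $H_j$. -}

module Defs where

open import Data.Nat using (ℕ; zero; suc; _+_; _*_; _<_; _≤_)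
open import Data.Fin using (Fin)
open import Data.List using (List; []; _∷_; length)
open import Data.List.Membership.Propositional using (_∈_)
open import Data.List.Relation.Unary.Unique.Propositional using (Unique)
open import Data.Product using (Σ; _×_; ∃)
open import Data.Sum using (_⊎_)
open import Relation.Nullary using (¬_)
open import Relation.Binary using (Decidable)
open import Relation.Binary.PropositionalEquality using (_≡_)

record SimpleGraph (N : ℕ) : Set₁ where
  field
    Adj   : Fin N → Fin N → Set
    adj?  : Decidable Adj
    sym   : ∀ {x y} → Adj x y → Adj y x
    irrefl : ∀ {x} → ¬ Adj x x

module _ {N : ℕ} (G : SimpleGraph N) where
  open SimpleGraph G

  data Walk : Fin N → Fin N → Set where
    nil  : ∀ {x} → Walk x x
    cons : ∀ {x y z} → Adj x y → Walk y z → Walk x z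

  walkLength : ∀ {x y} → Walk x y → ℕ
  walkLength nil = 0
  walkLength (cons _ w) = suc (walkLength w)

  Connected : Set
  Connected = ∀ x y → Walk x y

  data Chain : List (Fin N) → Set where
    []  : Chain []
    [-] : ∀ {x} → Chain (x ∷ [])
    _∷_ : ∀ {x y vs} → Adj x y → Chain (y ∷ vs) → Chain (x ∷ y ∷ vs)

  data Last : List (Fin N) → Fin N → Set where
    here  : ∀ {x} → Last (x ∷ []) x
    there : ∀ {x y vs} → Last vs y → Last (x ∷ vs) y

  Cycle : Set
  Cycle = Σ (List (Fin N)) λ vs → Σ (Fin N) λ v₀ → Σ (Fin N) λ vₖ →
            (3 ≤ length vs) × Chain vs × Unique vs ×
            (Σ (List (Fin N)) λ rest → vs ≡ v₀ ∷ rest) × Last vs vₖ × Adj vₖ v₀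

  Acyclic : Set
  Acyclic = ¬ Cycle

  IsTree : Set
  IsTree = Connected × Acyclic

  IsLeaf : Fin N → Set
  IsLeaf x = Σ (Fin N) λ y → Adj x y × (∀ z → Adj x z → z ≡ y)

  -- distance conditions, unfolding d(x,y) = min length of an x–y walk
  DistGt : Fin N → Fin N → ℕ → Set
  DistGt x y k = ∀ (w : Walk x y) → k < walkLength w

  DistGe : Fin N → Fin N → ℕ → Set
  DistGe x y k = ∀ (w : Walk x y) → k ≤ walkLength w

  Spindly : ℕ → Set
  Spindly n =
      (∀ x y → IsLeaf x → IsLeaf y → ¬ x ≡ y → DistGt x y (2 * n))
    ⊎ (Σ (Fin N) λ l → IsLeaf l ×
         (∀ x y → IsLeaf x → IsLeaf y → ¬ x ≡ y →
            ((¬ l ≡ x × ¬ l ≡ y) → DistGt x y (2 * n)) ×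
            ((l ≡ x ⊎ l ≡ y) → DistGe x y n)))

  record Path : Set where
    field
      verts  : List (Fin N)
      chain  : Chain verts
      unique : Unique verts

  pathLength : Path → ℕ
  pathLength p = Data.Nat._∸_ (length (Path.verts p)) 1

  data ConsecPair : List (Fin N) → Fin N → Fin N → Set where
    here  : ∀ {x y vs} → ConsecPair (x ∷ y ∷ vs) x y
    there : ∀ {x y z vs} → ConsecPair vs x y → ConsecPair (z ∷ vs) x y

  PathEdge : Path → Fin N → Fin N → Set
  PathEdge p x y = ConsecPair (Path.verts p) x y ⊎ ConsecPair (Path.verts p) y x

  PathVertex : Path → Fin N → Set
  PathVertex p x = x ∈ Path.verts p

  PathLeaf : Path → Fin N → Set
  PathLeaf p x = Σ (Fin N) λ y → PathEdge p x y × (∀ z → PathEdge p x z → z ≡ y)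

  -- G is the union of the paths p₀,…,pₘ (each path is a subgraph of G by construction)
  UnionIs : (m : ℕ) → (Fin (suc m) → Path) → Set
  UnionIs m p = (∀ x → Σ (Fin (suc m)) λ i → PathVertex (p i) x)
              × (∀ x y → Adj x y → Σ (Fin (suc m)) λ i → PathEdge (p i) x y)

  EdgeDisjoint : (m : ℕ) → (Fin (suc m) → Path) → Set
  EdgeDisjoint m p = ∀ i j → ¬ i ≡ j → ∀ x y → PathEdge (p i) x y → ¬ PathEdge (p j) x y

  EndOrdered : (m : ℕ) → (Fin (suc m) → Path) → Set
  EndOrdered m p = ∀ (i j : Fin (suc m)) → i Data.Fin.< j → ∀ x →
                     PathVertex (p i) x → PathVertex (p j) x → PathLeaf (p j) x

-- Root the tree at the distinguished leaf r (at any leaf if there is none) and add paths one at a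
-- time. At each stage the covered vertices, r and the vertices of the paths chosen so far, span a
-- subtree. Take an uncovered leaf x nearest to it and add a shortest path from the covered part to x:
-- it meets the earlier paths only in its first vertex, which is one of its ends, so the sequence
-- stays edge-disjoint and end-ordered. Its length is at least n because every uncovered leaf y stays
-- at distance at least n from the covered part. Initially this is the spindly condition at r; after
-- adding the path to x, a walk of length k from one of its vertices s to y is at least as long as
-- the part of the path from s to x (the path is shortest), and together they join the non-root
-- leaves x and y, so 2n < 2k. Once everything is covered, every edge lies on a path, as the tree has no cycles.
module Submission where

open import Level using (0ℓ)
open import Data.Nat using (ℕ; zero; suc; _+_; _*_; _∸_; _≤_; _<_; z≤n; s≤s)
open import Data.Nat.Properties
  using (_≤?_; ≰⇒>; <⇒≱; <⇒≤; ≤-refl; ≤-trans; ≤-reflexive; m≤n+m; m≤m+n; m≤n⇒m≤1+n;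
         +-suc; +-identityʳ; +-mono-<; +-monoˡ-≤; +-cancelˡ-≤; anyUpTo?)
open import Data.Nat.Induction using (<-wellFounded)
open import Induction.WellFounded using (Acc; acc)
open import Data.Fin using (Fin; zero; suc) renaming (_<_ to _<ᶠ_)
open import Data.Fin.Properties using (_≟_; any?; all?; pigeonhole; <-cmp)
open import Data.List using (List; []; _∷_; length; _++_; lookup)
open import Data.List.Membership.Propositional using (_∈_)
open import Data.List.Membership.Propositional.Properties using (∈-lookup)
open import Data.List.Relation.Binary.Subset.Propositional using (_⊆_)
open import Data.List.Relation.Binary.Disjoint.Propositional using (Disjoint)
open import Data.List.Relation.Unary.Any using (Any; here; there)
import Data.List.Relation.Unary.Any as Any
import Data.List.Relation.Unary.Any.Properties as Any
open import Data.List.Relation.Unary.All using (All; []; _∷_)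
import Data.List.Relation.Unary.All as All
import Data.List.Relation.Unary.All.Properties as All
open import Data.List.Relation.Unary.All.Properties using (¬Any⇒All¬; All¬⇒¬Any)
open import Data.List.Relation.Unary.AllPairs using (AllPairs; [])
open import Data.List.Relation.Unary.AllPairs.Core using (_∷_)
import Data.List.Relation.Unary.AllPairs.Properties as AllPairs
open import Data.List.Relation.Unary.Unique.Propositional using (Unique)
open import Data.List.Relation.Unary.Unique.Propositional.Properties using (++⁺)
open import Data.Product using (Σ; _×_; _,_; proj₁; proj₂)
open import Data.Sum using (_⊎_; inj₁; inj₂; [_,_]′; map₂)
open import Data.Empty using (⊥-elim)
open import Function using (_∘_; id)
open import Relation.Nullary using (Dec; yes; no; ¬_; ¬?)
open import Relation.Nullary.Decidable using (map′; _×-dec_; _→-dec_; _⊎-dec_; decidable-stable)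
open import Relation.Unary using (Decidable)
open import Relation.Binary using (Rel; DecidableEquality; tri<; tri≈; tri>)
open import Relation.Binary.PropositionalEquality using (_≡_; refl; sym; trans; cong; subst)
open import Relation.Binary.Construct.Closure.ReflexiveTransitive using (Star; ε; _◅_; _◅◅_; map; revApp; reverse)
open import Defs

module _ {A : Set} {R : Rel A 0ℓ} where

  len : ∀ {x y} → Star R x y → ℕ
  len ε = 0
  len (_ ◅ w) = suc (len w)

  tailVertices : ∀ {x y} → Star R x y → List A
  tailVertices ε = []
  tailVertices (_◅_ {j = y} _ w) = y ∷ tailVertices w

  vertices : ∀ {x y} → Star R x y → List A
  vertices {x} w = x ∷ tailVertices w

  Simple : ∀ {x y} → Star R x y → Set
  Simple w = Unique (vertices w)

  len-◅◅ : ∀ {x y z} (w₁ : Star R x y) (w₂ : Star R y z) → len (w₁ ◅◅ w₂) ≡ len w₁ + len w₂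
  len-◅◅ ε w₂ = refl
  len-◅◅ (_ ◅ w₁) w₂ = cong suc (len-◅◅ w₁ w₂)

  len-◅◅ʳ : ∀ {x y z} (w₁ : Star R x y) (w₂ : Star R y z) → len w₂ ≤ len (w₁ ◅◅ w₂)
  len-◅◅ʳ w₁ w₂ = ≤-trans (m≤n+m (len w₂) (len w₁)) (≤-reflexive (sym (len-◅◅ w₁ w₂)))

  length-vertices : ∀ {x y} (w : Star R x y) → length (vertices w) ≡ suc (len w)
  length-vertices ε = refl
  length-vertices (_ ◅ w) = cong suc (length-vertices w)

  end∈vertices : ∀ {x y} (w : Star R x y) → y ∈ vertices w
  end∈vertices ε = here refl
  end∈vertices (_ ◅ w) = there (end∈vertices w)

  tailVertices-◅◅-◅ : ∀ {x y y′ z} (w₁ : Star R x y) (e : R y y′) (w₂ : Star R y′ z) →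
                      tailVertices (w₁ ◅◅ e ◅ w₂) ≡ tailVertices w₁ ++ vertices w₂
  tailVertices-◅◅-◅ ε e w₂ = refl
  tailVertices-◅◅-◅ (_ ◅ w₁) e w₂ = cong (_ ∷_) (tailVertices-◅◅-◅ w₁ e w₂)

  ∈-◅◅⁺ˡ : ∀ {x y z v} (w₁ : Star R x y) (w₂ : Star R y z) → v ∈ vertices w₁ → v ∈ vertices (w₁ ◅◅ w₂)
  ∈-◅◅⁺ˡ ε (_ ◅ _) (here refl) = here refl
  ∈-◅◅⁺ˡ ε ε (here refl) = here refl
  ∈-◅◅⁺ˡ (_ ◅ w₁) w₂ (here eq) = here eq
  ∈-◅◅⁺ˡ (_ ◅ w₁) w₂ (there v∈) = there (∈-◅◅⁺ˡ w₁ w₂ v∈)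

  ∈-◅◅⁺ʳ : ∀ {x y z v} (w₁ : Star R x y) (w₂ : Star R y z) → v ∈ vertices w₂ → v ∈ vertices (w₁ ◅◅ w₂)
  ∈-◅◅⁺ʳ ε w₂ v∈ = v∈
  ∈-◅◅⁺ʳ (_ ◅ w₁) w₂ v∈ = there (∈-◅◅⁺ʳ w₁ w₂ v∈)

  splitAt : ∀ {x y v} (w : Star R x y) → v ∈ vertices w →
            Σ (Star R x v) λ w₁ → Σ (Star R v y) λ w₂ → w₁ ◅◅ w₂ ≡ w
  splitAt ε (here refl) = ε , ε , refl
  splitAt (e ◅ w) (here refl) = ε , e ◅ w , refl
  splitAt (e ◅ w) (there v∈) with splitAt w v∈
  ... | w₁ , w₂ , refl = e ◅ w₁ , w₂ , refl

  simple-◅◅ˡ : ∀ {x y z} (w₁ : Star R x y) (w₂ : Star R y z) → Simple (w₁ ◅◅ w₂) → Simple w₁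
  simple-◅◅ˡ ε w₂ _ = [] ∷ []
  simple-◅◅ˡ (_ ◅ w₁) w₂ (x∉ ∷ s) =
    ¬Any⇒All¬ _ (λ x∈ → All¬⇒¬Any x∉ (∈-◅◅⁺ˡ w₁ w₂ x∈)) ∷ simple-◅◅ˡ w₁ w₂ s

  simple-◅◅ʳ : ∀ {x y z} (w₁ : Star R x y) (w₂ : Star R y z) → Simple (w₁ ◅◅ w₂) → Simple w₂
  simple-◅◅ʳ ε w₂ s = s
  simple-◅◅ʳ (_ ◅ w₁) w₂ (_ ∷ s) = simple-◅◅ʳ w₁ w₂ s

  simple-◅◅-◅ : ∀ {x y y′ z} (w₁ : Star R x y) (e : R y y′) (w₂ : Star R y′ z) →
                Simple w₁ → Simple w₂ → Disjoint (vertices w₁) (vertices w₂) → Simple (w₁ ◅◅ e ◅ w₂)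
  simple-◅◅-◅ {x} w₁ e w₂ s₁ s₂ disjoint =
    subst Unique (cong (x ∷_) (sym (tailVertices-◅◅-◅ w₁ e w₂))) (++⁺ s₁ s₂ disjoint)

  second : ∀ {x y} → Star R x y → A
  second {x} ε = x
  second (_◅_ {j = y} _ _) = y

  step-to-second : ∀ {x y} (w : Star R x y) → ¬ x ≡ y → R x (second w)
  step-to-second ε x≢x = ⊥-elim (x≢x refl)
  step-to-second (e ◅ _) _ = e

  second-◅◅ : ∀ {x y z} (w₁ : Star R x y) (w₂ : Star R y z) → ¬ x ≡ y → second (w₁ ◅◅ w₂) ≡ second w₁
  second-◅◅ ε w₂ x≢x = ⊥-elim (x≢x refl)
  second-◅◅ (_ ◅ _) w₂ _ = refl

  second-◅◅-◅ : ∀ {x y y′ z z′} (w : Star R x y) (e : R y y′) (w₁ : Star R y′ z) (w₂ : Star R y′ z′) →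
                second (w ◅◅ e ◅ w₁) ≡ second (w ◅◅ e ◅ w₂)
  second-◅◅-◅ ε e w₁ w₂ = refl
  second-◅◅-◅ (_ ◅ _) e w₁ w₂ = refl

  module _ (_≟_ : DecidableEquality A) where
    open import Data.List.Membership.DecPropositional _≟_ using (_∈?_)

    loopErase : ∀ {x y} (w : Star R x y) →
                Σ (Star R x y) λ w′ → Simple w′ × len w′ ≤ len w × vertices w′ ⊆ vertices w
    loopErase ε = ε , [] ∷ [] , z≤n , id
    loopErase {x} (e ◅ w) with loopErase w
    ... | w′ , simple , shorter , sub with x ∈? vertices w′
    ...   | yes x∈ with splitAt w′ x∈
    ...     | w₁ , w₂ , refl =
                w₂ , simple-◅◅ʳ w₁ w₂ simple ,
                m≤n⇒m≤1+n (≤-trans (len-◅◅ʳ w₁ w₂) shorter) ,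
                λ v∈ → there (sub (∈-◅◅⁺ʳ w₁ w₂ v∈))
    loopErase {x} (e ◅ w) | w′ , simple , shorter , sub | no x∉ =
      e ◅ w′ , ¬Any⇒All¬ _ x∉ ∷ simple , s≤s shorter ,
      λ { (here eq) → here eq ; (there v∈) → there (sub v∈) }

  module _ {P : A → Set} (P? : ∀ x → Dec (P x)) where

    suffixFromLast : ∀ {x y} (w : Star R x y) → Any P (vertices w) →
                     Σ A λ u → P u × Σ (Star R x u) λ w₁ → Σ (Star R u y) λ w₂ →
                       w₁ ◅◅ w₂ ≡ w × All (λ v → ¬ P v) (tailVertices w₂)
    suffixFromLast ε (here p) = _ , p , ε , ε , refl , []
    suffixFromLast (e ◅ w) p∈ with Any.any? P? (vertices w)
    ... | yes p∈w with suffixFromLast w p∈w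
    ...   | u , pu , w₁ , w₂ , refl , outside = u , pu , e ◅ w₁ , w₂ , refl , outside
    suffixFromLast (e ◅ w) (here p) | no ¬p∈w = _ , p , ε , e ◅ w , refl , ¬Any⇒All¬ _ ¬p∈w
    suffixFromLast (e ◅ w) (there p∈w) | no ¬p∈w = ⊥-elim (¬p∈w p∈w)

module _ {A : Set} {R S : Rel A 0ℓ} where

  tailVertices-map : (f : ∀ {a b} → R a b → S a b) → ∀ {x y} (w : Star R x y) →
                     tailVertices (map f w) ≡ tailVertices w
  tailVertices-map f ε = refl
  tailVertices-map f (_◅_ {j = y} e w) = cong (y ∷_) (tailVertices-map f w)

  vertices-map : (f : ∀ {a b} → R a b → S a b) → ∀ {x y} (w : Star R x y) → vertices (map f w) ≡ vertices w
  vertices-map f {x} w = cong (x ∷_) (tailVertices-map f w)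

  len-revApp : (f : ∀ {a b} → R a b → S b a) → ∀ {x y z} (w₁ : Star R y x) (w₂ : Star S y z) →
               len (revApp f w₁ w₂) ≡ len w₁ + len w₂
  len-revApp f ε w₂ = refl
  len-revApp f (e ◅ w₁) w₂ = trans (len-revApp f w₁ (f e ◅ w₂)) (+-suc (len w₁) (len w₂))

  len-reverse : (f : ∀ {a b} → R a b → S b a) → ∀ {x y} (w : Star R x y) → len (reverse f w) ≡ len w
  len-reverse f w = trans (len-revApp f w ε) (+-identityʳ (len w))

module _ {N : ℕ} (G : SimpleGraph N) where
  open SimpleGraph G renaming (sym to Adj-sym)

  toWalk : ∀ {x y} → Star Adj x y → Walk G x y
  toWalk ε = nil
  toWalk (e ◅ w) = cons e (toWalk w)

  walkLength-toWalk : ∀ {x y} (w : Star Adj x y) → walkLength G (toWalk w) ≡ len w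
  walkLength-toWalk ε = refl
  walkLength-toWalk (e ◅ w) = cong suc (walkLength-toWalk w)

  fromWalk : ∀ {x y} → Walk G x y → Star Adj x y
  fromWalk nil = ε
  fromWalk (cons e w) = e ◅ fromWalk w

  chain-vertices : ∀ {x y} (w : Star Adj x y) → Chain G (vertices w)
  chain-vertices ε = [-]
  chain-vertices (e ◅ ε) = e ∷ [-]
  chain-vertices (e ◅ e′ ◅ w) = e ∷ chain-vertices (e′ ◅ w)

  last-vertices : ∀ {x y} (w : Star Adj x y) → Last G (vertices w) y
  last-vertices ε = here
  last-vertices (e ◅ w) = there (last-vertices w)

  toPath : ∀ {x y} (w : Star Adj x y) → Simple w → Path G
  toPath w simple = record { verts = vertices w ; chain = chain-vertices w ; unique = simple }

  pathLength-toPath : ∀ {x y} (w : Star Adj x y) (simple : Simple w) → pathLength G (toPath w simple) ≡ len w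
  pathLength-toPath w _ = cong (_∸ 1) (length-vertices w)

  simple-walk-to-neighbour : Acyclic G → ∀ {x y} (w : Star Adj x y) → Simple w → Adj x y → second w ≡ y
  simple-walk-to-neighbour acyclic ε _ x~x = ⊥-elim (irrefl x~x)
  simple-walk-to-neighbour acyclic (e ◅ ε) _ _ = refl
  simple-walk-to-neighbour acyclic {x} {y} w@(_ ◅ _ ◅ _) simple x~y =
    ⊥-elim (acyclic (vertices w , x , y , s≤s (s≤s (s≤s z≤n)) , chain-vertices w , simple ,
                     (tailVertices w , refl) , last-vertices w , Adj-sym x~y))

  neighbour-on-simple-walk-is-second : Acyclic G → ∀ {x y z} (w : Star Adj x y) → Simple w →
                                       Adj x z → z ∈ vertices w → second w ≡ z
  neighbour-on-simple-walk-is-second acyclic w simple x~z z∈ with splitAt w z∈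
  ... | w₁ , w₂ , refl =
    trans (second-◅◅ w₁ w₂ (λ { refl → irrefl x~z }))
          (simple-walk-to-neighbour acyclic w₁ (simple-◅◅ˡ w₁ w₂ simple) x~z)

  consecPair⇒∈ˡ : ∀ {vs a b} → ConsecPair G vs a b → a ∈ vs
  consecPair⇒∈ˡ here = here refl
  consecPair⇒∈ˡ (there p) = there (consecPair⇒∈ˡ p)

  consecPair⇒∈ʳ : ∀ {vs a b} → ConsecPair G vs a b → b ∈ vs
  consecPair⇒∈ʳ here = there (here refl)
  consecPair⇒∈ʳ (there p) = there (consecPair⇒∈ʳ p)

  consecPair⇒∈tail : ∀ {v vs a b} → ConsecPair G (v ∷ vs) a b → b ∈ vs
  consecPair⇒∈tail here = here refl
  consecPair⇒∈tail (there p) = consecPair⇒∈ʳ p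

  consecPair⇒Adj : ∀ {vs a b} → Chain G vs → ConsecPair G vs a b → Adj a b
  consecPair⇒Adj (a~b ∷ _) here = a~b
  consecPair⇒Adj (_ ∷ chain) (there p) = consecPair⇒Adj chain p

  pathEdge⇒Adj : ∀ p {a b} → PathEdge G p a b → Adj a b
  pathEdge⇒Adj p (inj₁ c) = consecPair⇒Adj (Path.chain p) c
  pathEdge⇒Adj p (inj₂ c) = Adj-sym (consecPair⇒Adj (Path.chain p) c)

  walkAlong : ∀ {a b v} (w : Star Adj a b) → v ∈ vertices w → Star (ConsecPair G (vertices w)) a v
  walkAlong ε (here refl) = ε
  walkAlong (e ◅ w) (here refl) = ε
  walkAlong (e ◅ w) (there v∈) = here ◅ map there (walkAlong w v∈)

  start-pathLeaf : ∀ {x y} (w : Star Adj x y) (simple : Simple w) → ¬ x ≡ y → PathLeaf G (toPath w simple) x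
  start-pathLeaf ε _ x≢x = ⊥-elim (x≢x refl)
  start-pathLeaf w@(_◅_ {j = y} _ _) simple@(x∉ ∷ _) _ = y , inj₁ here , only-y
    where
    only-y : ∀ z → PathEdge G (toPath w simple) _ z → z ≡ y
    only-y z (inj₁ here) = refl
    only-y z (inj₁ (there p)) = ⊥-elim (All¬⇒¬Any x∉ (consecPair⇒∈ˡ p))
    only-y z (inj₂ here) = ⊥-elim (All¬⇒¬Any x∉ (here refl))
    only-y z (inj₂ (there p)) = ⊥-elim (All¬⇒¬Any x∉ (consecPair⇒∈ʳ p))

  isLeaf? : ∀ x → Dec (IsLeaf G x)
  isLeaf? x = any? λ y → adj? x y ×-dec all? (λ z → adj? x z →-dec (z ≟ y))

  ¬leaf⇒another-neighbour : ∀ {x y} → ¬ IsLeaf G x → Adj x y → Σ (Fin N) λ z → Adj x z × ¬ z ≡ y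
  ¬leaf⇒another-neighbour {x} {y} ¬leaf x~y with any? (λ z → adj? x z ×-dec ¬? (z ≟ y))
  ... | yes another = another
  ... | no ¬another = ⊥-elim (¬leaf (y , x~y , only-y))
    where
    only-y : ∀ z → Adj x z → z ≡ y
    only-y z x~z = decidable-stable (z ≟ y) λ z≢y → ¬another (z , x~z , z≢y)

module _ {A : Set} {R : A → A → Set} where

  AllPairs-lookup : ∀ {xs : List A} → AllPairs R xs →
                    ∀ {i j : Fin (length xs)} → i <ᶠ j → R (lookup xs i) (lookup xs j)
  AllPairs-lookup (r ∷ _) {zero} {suc j} _ = All.lookup r (∈-lookup j)
  AllPairs-lookup (_ ∷ rs) {suc i} {suc j} (s≤s i<j) = AllPairs-lookup rs i<j

unique⇒length≤ : ∀ {N} (xs : List (Fin N)) → Unique xs → length xs ≤ N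
unique⇒length≤ {N} xs unique with length xs ≤? N
... | yes ≤N = ≤N
... | no ≰N with pigeonhole (≰⇒> ≰N) (lookup xs)
...   | i , j , i<j , eq = ⊥-elim (AllPairs-lookup unique i<j eq)

module ExitLeaf {N : ℕ} (G : SimpleGraph N) (connected : Connected G) (acyclic : Acyclic G)
                {S : Fin N → Set} (S? : Decidable S)
                (S-connected : ∀ {a b} → S a → S b → Σ (Star (SimpleGraph.Adj G) a b) (All S ∘ vertices)) where
  open SimpleGraph G renaming (sym to Adj-sym)
  open import Data.List.Membership.DecPropositional (_≟_ {N}) using (_∈?_)

  exitEdge : ∀ {a b} → Star Adj a b → S a → ¬ S b → Σ (Fin N) λ u → Σ (Fin N) λ c → S u × ¬ S c × Adj u c
  exitEdge ε Sa ¬Sb = ⊥-elim (¬Sb Sa)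
  exitEdge (_◅_ {j = c} e w) Sa ¬Sb with S? c
  ... | yes Sc = exitEdge w Sc ¬Sb
  ... | no ¬Sc = _ , c , Sa , ¬Sc , e

  LeafOutside : Set
  LeafOutside = Σ (Fin N) λ u → S u × Σ (Fin N) λ y → IsLeaf G y × ¬ S y × Star Adj u y

  -- ω runs back from the current end e to c, whose neighbour u lies in S, so e was entered from
  -- second (ω ◅◅ c~u ◅ ε); any other neighbour of e is neither on the walk nor in S, since
  -- either would close a cycle.
  module _ {e c u z} (ω : Star Adj e c) (c~u : Adj c u) (Su : S u)
           (simple : Simple ω) (outside : All (¬_ ∘ S) (vertices ω)) (e~z : Adj e z) where

    neighbour-on-walk-back : z ∈ vertices (ω ◅◅ c~u ◅ ε) → z ≡ second (ω ◅◅ c~u ◅ ε)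
    neighbour-on-walk-back z∈ = sym (neighbour-on-simple-walk-is-second G acyclic _ φ-simple e~z z∈)
      where
      φ-simple : Simple (ω ◅◅ c~u ◅ ε)
      φ-simple = simple-◅◅-◅ ω c~u ε simple ([] ∷ []) λ { (v∈ω , here refl) → All.lookup outside v∈ω Su }

    neighbour-in-S : S z → z ≡ second (ω ◅◅ c~u ◅ ε)
    neighbour-in-S Sz with S-connected Su Sz
    ... | π₀ , π₀-inside with loopErase _≟_ π₀
    ...   | π , π-simple , _ , π⊆π₀ =
      sym (trans (second-◅◅-◅ ω c~u ε π)
                 (neighbour-on-simple-walk-is-second G acyclic (ω ◅◅ c~u ◅ π) ψ-simple e~z (end∈vertices _)))
      where
      ψ-simple : Simple (ω ◅◅ c~u ◅ π)
      ψ-simple = simple-◅◅-◅ ω c~u π simple π-simple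
                   λ (v∈ω , v∈π) → All.lookup outside v∈ω (All.lookup π₀-inside (π⊆π₀ v∈π))

  growToLeaf : ∀ (fuel : ℕ) {e c u} (ω : Star Adj e c) (c~u : Adj c u) → S u →
               Simple ω → All (¬_ ∘ S) (vertices ω) → N < length (vertices ω) + fuel → LeafOutside
  growToLeaf zero ω c~u Su simple outside bound =
    ⊥-elim (<⇒≱ (subst (N <_) (+-identityʳ _) bound) (unique⇒length≤ _ simple))
  growToLeaf (suc fuel) {e} {c} {u} ω c~u Su simple outside bound with isLeaf? G e
  ... | yes leaf = u , Su , e , leaf , All.head outside , reverse Adj-sym (ω ◅◅ c~u ◅ ε)
  ... | no ¬leaf with ¬leaf⇒another-neighbour G ¬leaf (step-to-second (ω ◅◅ c~u ◅ ε) e≢u)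
    where
    e≢u : ¬ e ≡ u
    e≢u refl = All.head outside Su
  ...   | z , e~z , z≢p with z ∈? vertices (ω ◅◅ c~u ◅ ε) | S? z
  ...     | yes z∈φ | _ = ⊥-elim (z≢p (neighbour-on-walk-back ω c~u Su simple outside e~z z∈φ))
  ...     | no _ | yes Sz = ⊥-elim (z≢p (neighbour-in-S ω c~u Su simple outside e~z Sz))
  ...     | no z∉φ | no ¬Sz = growToLeaf fuel (Adj-sym e~z ◅ ω) c~u Su
                                (¬Any⇒All¬ _ (z∉φ ∘ ∈-◅◅⁺ˡ ω (c~u ◅ ε)) ∷ simple) (¬Sz ∷ outside)
                                (subst (N <_) (+-suc _ fuel) bound)

  leafOutside : ∀ {s v} → S s → ¬ S v → LeafOutside
  leafOutside {s} {v} Ss ¬Sv with exitEdge (fromWalk G (connected s v)) Ss ¬Sv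
  ... | u , c , Su , ¬Sc , u~c = growToLeaf N ε (Adj-sym u~c) Su ([] ∷ []) (¬Sc ∷ []) ≤-refl

least : ∀ {P : ℕ → Set} → Decidable P → ∀ {k} → P k → Σ ℕ λ m → P m × (∀ {j} → j < m → ¬ P j)
least {P} P? {k} = search (<-wellFounded k)
  where
  search : ∀ {k} → Acc _<_ k → P k → Σ ℕ λ m → P m × (∀ {j} → j < m → ¬ P j)
  search {k} (acc smaller) Pk with anyUpTo? P? k
  ... | yes (j , j<k , Pj) = search (smaller j<k) Pj
  ... | no none = k , Pk , λ j<k Pj → none (_ , j<k , Pj)

module NearestLeaf {N : ℕ} (G : SimpleGraph N) {S : Fin N → Set} (S? : Decidable S) where
  open SimpleGraph G renaming (sym to Adj-sym)

  data Reaches : ℕ → Fin N → Set where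
    here : ∀ {x} → S x → Reaches 0 x
    next : ∀ {k x y} → Adj x y → Reaches k y → Reaches (suc k) x

  reaches? : ∀ k x → Dec (Reaches k x)
  reaches? zero x = map′ here (λ { (here Sx) → Sx }) (S? x)
  reaches? (suc k) x = map′ (λ (y , x~y , r) → next x~y r) (λ { (next x~y r) → _ , x~y , r })
                            (any? λ y → adj? x y ×-dec reaches? k y)

  walk⇒reaches : ∀ {x s} → S s → (w : Star Adj x s) → Reaches (len w) x
  walk⇒reaches Ss ε = here Ss
  walk⇒reaches Ss (e ◅ w) = next e (walk⇒reaches Ss w)

  reaches⇒walk : ∀ {k x} → Reaches k x → Σ (Fin N) λ s → S s × Σ (Star Adj x s) λ w → len w ≡ k
  reaches⇒walk (here Sx) = _ , Sx , ε , refl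
  reaches⇒walk (next e r) with reaches⇒walk r
  ... | s , Ss , w , refl = s , Ss , e ◅ w , refl

  LeafAtDistance : ℕ → Set
  LeafAtDistance k = Σ (Fin N) λ y → (IsLeaf G y × ¬ S y) × Reaches k y

  leafAtDistance? : Decidable LeafAtDistance
  leafAtDistance? k = any? λ y → (isLeaf? G y ×-dec ¬? (S? y)) ×-dec reaches? k y

  record Nearest : Set where
    field
      {u x}    : Fin N
      u∈S      : S u
      x-leaf   : IsLeaf G x
      x∉S      : ¬ S x
      path     : Star Adj u x
      simple   : Simple path
      beyond-S : All (¬_ ∘ S) (tailVertices path)
      shortest : ∀ {s y} → S s → IsLeaf G y → ¬ S y → (w : Star Adj s y) → len path ≤ len w

  reached-by : ∀ {s y} → S s → (w : Star Adj s y) → Reaches (len w) y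
  reached-by Ss w = subst (λ k → Reaches k _) (len-reverse Adj-sym w) (walk⇒reaches Ss (reverse Adj-sym w))

  nearest : ∀ {s y} → S s → IsLeaf G y → ¬ S y → Star Adj s y → Nearest
  nearest {y = y} Ss y-leaf ¬Sy w with least leafAtDistance? (y , (y-leaf , ¬Sy) , reached-by Ss w)
  ... | m , (x , (x-leaf , ¬Sx) , r) , minimal with reaches⇒walk r
  ...   | s₁ , Ss₁ , w₁ , refl with loopErase _≟_ (reverse Adj-sym w₁)
  ...     | w₂ , simple₂ , shorter₂ , _ with suffixFromLast S? w₂ (here Ss₁)
  ...       | u , Su , w₀ , w₃ , split , outside = record
    { u∈S = Su ; x-leaf = x-leaf ; x∉S = ¬Sx ; path = w₃
    ; simple = simple-◅◅ʳ w₀ w₃ (subst Simple (sym split) simple₂)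
    ; beyond-S = outside
    ; shortest = λ Ss′ y′-leaf ¬Sy′ w′ → ≤-trans w₃≤m (m≤ Ss′ y′-leaf ¬Sy′ w′) }
    where
    w₃≤m : len w₃ ≤ len w₁
    w₃≤m = ≤-trans (len-◅◅ʳ w₀ w₃)
             (≤-trans (≤-reflexive (cong len split)) (≤-trans shorter₂ (≤-reflexive (len-reverse Adj-sym w₁))))
    m≤ : ∀ {s′ y′} → S s′ → IsLeaf G y′ → ¬ S y′ → (w′ : Star Adj s′ y′) → len w₁ ≤ len w′
    m≤ Ss′ y′-leaf ¬Sy′ w′ with len w₁ ≤? len w′
    ... | yes m≤w′ = m≤w′
    ... | no m≰w′ = ⊥-elim (minimal (≰⇒> m≰w′) (_ , (y′-leaf , ¬Sy′) , reached-by Ss′ w′))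

2*n<a+b∧a≤b⇒n≤b : ∀ {n a b} → 2 * n < a + b → a ≤ b → n ≤ b
2*n<a+b∧a≤b⇒n≤b {n} {a} {b} 2n<a+b a≤b with n ≤? b
... | yes n≤b = n≤b
... | no n≰b = ⊥-elim (<⇒≱ 2n<a+b (≤-trans (+-monoˡ-≤ b a≤b) (<⇒≤ b+b<2n)))
  where
  b+b<2n : b + b < 2 * n
  b+b<2n = subst (b + b <_) (cong (n +_) (sym (+-identityʳ n))) (+-mono-< (≰⇒> n≰b) (≰⇒> n≰b))

module _ {N : ℕ} (G : SimpleGraph N) (n : ℕ) where

  LeavesFarApart : Fin N → Set
  LeavesFarApart r = ∀ {x y} → IsLeaf G x → IsLeaf G y → ¬ x ≡ y → ¬ x ≡ r → ¬ y ≡ r → DistGt G x y (2 * n)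

  LeavesFarFromRoot : Fin N → Set
  LeavesFarFromRoot r = ∀ {y} → IsLeaf G y → ¬ y ≡ r → DistGe G r y n

  spindly⇒root : Connected G → Acyclic G → ∀ {a b : Fin N} → ¬ b ≡ a → Spindly G n →
                 Σ (Fin N) λ r → LeavesFarApart r × LeavesFarFromRoot r
  spindly⇒root connected acyclic {a} b≢a (inj₁ far-apart)
    with ExitLeaf.leafOutside G connected acyclic (_≟ a) (λ { refl refl → ε , refl ∷ [] }) refl b≢a
  ... | _ , _ , r , r-leaf , _ =
    r , (λ x-leaf y-leaf x≢y _ _ → far-apart _ _ x-leaf y-leaf x≢y) ,
        (λ y-leaf y≢r w → ≤-trans (m≤m+n n _) (<⇒≤ (far-apart _ _ r-leaf y-leaf (y≢r ∘ sym) w)))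
  spindly⇒root connected acyclic _ (inj₂ (l , l-leaf , h)) =
    l , (λ x-leaf y-leaf x≢y x≢l y≢l → proj₁ (h _ _ x-leaf y-leaf x≢y) (x≢l ∘ sym , y≢l ∘ sym)) ,
        (λ y-leaf y≢l → proj₂ (h _ _ l-leaf y-leaf (y≢l ∘ sym)) (inj₁ refl))

another-vertex : ∀ {k} (r : Fin (suc (suc k))) → Σ (Fin (suc (suc k))) λ a → ¬ a ≡ r
another-vertex zero = suc zero , λ ()
another-vertex (suc _) = zero , λ ()

module Construction {N : ℕ} (G : SimpleGraph N) (connected : Connected G) (acyclic : Acyclic G)
                    (n : ℕ) (r : Fin N) (far-apart : LeavesFarApart G n r) (far-from-root : LeavesFarFromRoot G n r)
  where
  open SimpleGraph G renaming (sym to Adj-sym)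
  open import Data.List.Membership.DecPropositional (_≟_ {N}) using (_∈?_)

  Covered : List (Path G) → Fin N → Set
  Covered ps x = x ≡ r ⊎ Any (λ p → PathVertex G p x) ps

  covered? : ∀ ps x → Dec (Covered ps x)
  covered? ps x = (x ≟ r) ⊎-dec Any.any? (λ p → x ∈? Path.verts p) ps

  Edge : List (Path G) → Fin N → Fin N → Set
  Edge ps x y = Any (λ p → PathEdge G p x y) ps

  Edge-sym : ∀ {ps x y} → Edge ps x y → Edge ps y x
  Edge-sym = Any.map [ inj₂ , inj₁ ]′

  Edge⇒Adj : ∀ {ps x y} → Edge ps x y → Adj x y
  Edge⇒Adj {p ∷ _} (here e) = pathEdge⇒Adj G p e
  Edge⇒Adj (there e) = Edge⇒Adj e

  Edge⇒covered : ∀ {ps x y} → Edge ps x y → Covered ps y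
  Edge⇒covered e = inj₂ (Any.map (λ { (inj₁ c) → consecPair⇒∈ʳ G c ; (inj₂ c) → consecPair⇒∈ˡ G c }) e)

  Edge⇒covered-start : ∀ {ps x y} → Edge ps x y → Any (λ p → PathVertex G p x) ps
  Edge⇒covered-start = Any.map λ { (inj₁ c) → consecPair⇒∈ˡ G c ; (inj₂ c) → consecPair⇒∈ʳ G c }

  covered-vertices : ∀ {ps x y} → Covered ps x → (w : Star (Edge ps) x y) → All (Covered ps) (vertices w)
  covered-vertices Cx ε = Cx ∷ []
  covered-vertices Cx (e ◅ w) = Cx ∷ covered-vertices (Edge⇒covered e) w

  Precedes : Path G → Path G → Set
  Precedes p q = (∀ v → PathVertex G p v → PathVertex G q v → PathLeaf G q v)
               × (∀ a b → PathEdge G p a b → ¬ PathEdge G q a b)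

  record Invariant (ps : List (Path G)) : Set where
    field
      long      : All (λ p → n ≤ pathLength G p) ps
      ordered   : AllPairs Precedes ps
      reachable : ∀ {x} → Covered ps x → Star (Edge ps) r x
      remote    : ∀ {s y} → Covered ps s → IsLeaf G y → ¬ Covered ps y → (w : Star Adj s y) → n ≤ len w

  covered-connected : ∀ {ps} → Invariant ps → ∀ {a b} → Covered ps a → Covered ps b →
                      Σ (Star Adj a b) (All (Covered ps) ∘ vertices)
  covered-connected inv Ca Cb =
    map Edge⇒Adj ω , subst (All _) (sym (vertices-map Edge⇒Adj ω)) (covered-vertices Ca ω)
    where
    open Invariant inv
    ω = reverse Edge-sym (reachable Ca) ◅◅ reachable Cb

  module Extend {ps : List (Path G)} (inv : Invariant ps) (near : NearestLeaf.Nearest G (covered? ps)) where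
    open Invariant inv
    open NearestLeaf.Nearest near

    P : Path G
    P = toPath G path simple

    ps′ : List (Path G)
    ps′ = ps ++ P ∷ []

    covered-old : ∀ {v} → Covered ps v → Covered ps′ v
    covered-old = map₂ Any.++⁺ˡ

    covered-new : ∀ {v} → v ∈ vertices path → Covered ps′ v
    covered-new v∈ = inj₂ (Any.++⁺ʳ ps (here v∈))

    covered-cases : ∀ {v} → Covered ps′ v → Covered ps v ⊎ v ∈ vertices path
    covered-cases (inj₁ v≡r) = inj₁ (inj₁ v≡r)
    covered-cases (inj₂ v∈) with Any.++⁻ ps v∈
    ... | inj₁ v∈ps = inj₁ (inj₂ v∈ps)
    ... | inj₂ (here v∈P) = inj₂ v∈P

    meets-covered-only-at-start : ∀ {v} → v ∈ vertices path → Covered ps v → v ≡ u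
    meets-covered-only-at-start (here v≡u) _ = v≡u
    meets-covered-only-at-start (there v∈) Cv = ⊥-elim (All.lookup beyond-S v∈ Cv)

    precedes-P : ∀ {q} → q ∈ ps → Precedes q P
    precedes-P {q} q∈ = meet-at-leaf , edge-disjoint
      where
      in-ps : ∀ {a b} → PathEdge G q a b → Edge ps a b
      in-ps e = Any.map (λ { refl → e }) q∈

      meet-at-leaf : ∀ v → PathVertex G q v → PathVertex G P v → PathLeaf G P v
      meet-at-leaf v v∈q v∈P =
        subst (PathLeaf G P) (sym (meets-covered-only-at-start v∈P (inj₂ (Any.map (λ { refl → v∈q }) q∈))))
              (start-pathLeaf G path simple (λ { refl → x∉S u∈S }))

      edge-disjoint : ∀ a b → PathEdge G q a b → ¬ PathEdge G P a b
      edge-disjoint a b eq (inj₁ c) = All.lookup beyond-S (consecPair⇒∈tail G c) (Edge⇒covered (in-ps eq))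
      edge-disjoint a b eq (inj₂ c) = All.lookup beyond-S (consecPair⇒∈tail G c) (Edge⇒covered (Edge-sym (in-ps eq)))

    reachable′ : ∀ {v} → Covered ps′ v → Star (Edge ps′) r v
    reachable′ Cv with covered-cases Cv
    ... | inj₁ Cv-old = map Any.++⁺ˡ (reachable Cv-old)
    ... | inj₂ v∈ = map Any.++⁺ˡ (reachable u∈S) ◅◅ map (λ c → Any.++⁺ʳ ps (here (inj₁ c))) (walkAlong G path v∈)

    remote-from-P : ∀ {s y} → s ∈ vertices path → IsLeaf G y → ¬ Covered ps′ y → (w : Star Adj s y) → n ≤ len w
    remote-from-P s∈ y-leaf ¬Cy w with splitAt path s∈
    ... | w₁ , w₂ , split = 2*n<a+b∧a≤b⇒n≤b x-far-from-y w₂≤w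
      where
      ρ = reverse Adj-sym w₂ ◅◅ w
      x-far-from-y : 2 * n < len w₂ + len w
      x-far-from-y = subst (2 * n <_)
        (trans (walkLength-toWalk G ρ) (trans (len-◅◅ (reverse Adj-sym w₂) w) (cong (_+ len w) (len-reverse Adj-sym w₂))))
        (far-apart x-leaf y-leaf (λ { refl → ¬Cy (covered-new (end∈vertices path)) })
                   (x∉S ∘ inj₁) (¬Cy ∘ covered-old ∘ inj₁) (toWalk G ρ))
      w₂≤w : len w₂ ≤ len w
      w₂≤w = +-cancelˡ-≤ (len w₁) (len w₂) (len w)
        (subst (_≤ len w₁ + len w) (trans (cong len (sym split)) (len-◅◅ w₁ w₂))
          (subst (len path ≤_) (len-◅◅ w₁ w) (shortest u∈S y-leaf (¬Cy ∘ covered-old) (w₁ ◅◅ w))))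

    invariant′ : Invariant ps′
    invariant′ = record
      { long = All.++⁺ long (subst (n ≤_) (sym (pathLength-toPath G path simple)) (remote u∈S x-leaf x∉S path) ∷ [])
      ; ordered = AllPairs.++⁺ ordered ([] ∷ []) (All.tabulate λ q∈ → precedes-P q∈ ∷ [])
      ; reachable = reachable′
      ; remote = remote′ }
      where
      remote′ : ∀ {s y} → Covered ps′ s → IsLeaf G y → ¬ Covered ps′ y → (w : Star Adj s y) → n ≤ len w
      remote′ Cs y-leaf ¬Cy w with covered-cases Cs
      ... | inj₁ Cs-old = remote Cs-old y-leaf (¬Cy ∘ covered-old) w
      ... | inj₂ s∈ = remote-from-P s∈ y-leaf ¬Cy w

  invariant₀ : Invariant []
  invariant₀ = record
    { long = []
    ; ordered = []
    ; reachable = λ { (inj₁ refl) → ε ; (inj₂ ()) }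
    ; remote = λ { (inj₁ refl) y-leaf ¬Cy w →
                     subst (n ≤_) (walkLength-toWalk G w) (far-from-root y-leaf (¬Cy ∘ inj₁) (toWalk G w))
                 ; (inj₂ ()) _ _ _ } }

  Saturated : Set
  Saturated = Σ (List (Path G)) λ ps → Invariant ps × (∀ v → Covered ps v)

  -- Every step covers a new vertex, recorded in the duplicate-free list D, so N steps suffice.
  saturate : ∀ (fuel : ℕ) {ps} → Invariant ps → (D : List (Fin N)) → Unique D → All (Covered ps) D →
             N < length D + fuel → Saturated
  saturate fuel {ps} inv D D-unique D-covered bound with any? (λ v → ¬? (covered? ps v))
  ... | no none = ps , inv , λ v → decidable-stable (covered? ps v) (λ ¬Cv → none (v , ¬Cv))
  saturate zero inv D D-unique D-covered bound | yes _ =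
    ⊥-elim (<⇒≱ (subst (N <_) (+-identityʳ _) bound) (unique⇒length≤ D D-unique))
  saturate (suc fuel) {ps} inv D D-unique D-covered bound | yes (v , ¬Cv)
    with ExitLeaf.leafOutside G connected acyclic (covered? ps) (covered-connected inv) (inj₁ refl) ¬Cv
  ... | u , Cu , y , y-leaf , ¬Cy , w =
    saturate fuel E.invariant′ (x ∷ D)
             (¬Any⇒All¬ D (x∉S ∘ All.lookup D-covered) ∷ D-unique)
             (E.covered-new (end∈vertices path) ∷ All.map E.covered-old D-covered)
             (subst (N <_) (+-suc (length D) fuel) bound)
    where
    near = NearestLeaf.nearest G (covered? ps) Cu y-leaf ¬Cy w
    module E = Extend inv near
    open NearestLeaf.Nearest near using (x; x∉S; path)

  saturated : Saturated
  saturated = saturate N invariant₀ (r ∷ []) ([] ∷ []) (inj₁ refl ∷ []) ≤-refl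

  IsDecomposition : (m : ℕ) → (Fin (suc m) → Path G) → Set
  IsDecomposition m p = (∀ i → n ≤ pathLength G (p i)) × UnionIs G m p × EdgeDisjoint G m p × EndOrdered G m p

  every-edge-on-a-path : ∀ {ps} → Invariant ps → (∀ v → Covered ps v) → ∀ {x y} → Adj x y → Edge ps x y
  every-edge-on-a-path {ps} inv all-covered {x} {y} x~y
    with loopErase _≟_ (reverse Edge-sym (reachable (all-covered x)) ◅◅ reachable (all-covered y))
    where open Invariant inv
  ... | ρ , ρ-simple , _ = single-edge ρ ρ-simple
    where
    single-edge : (ρ : Star (Edge ps) x y) → Simple ρ → Edge ps x y
    single-edge ε _ = ⊥-elim (irrefl x~y)
    single-edge ρ@(e ◅ _) simple =
      subst (Edge ps x) (simple-walk-to-neighbour G acyclic (map Edge⇒Adj ρ)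
                           (subst Unique (sym (vertices-map Edge⇒Adj ρ)) simple) x~y) e

  decomposition : ∀ {p₀ rest} → Invariant (p₀ ∷ rest) → (∀ v → Covered (p₀ ∷ rest) v) →
                  Any (λ p → PathVertex G p r) (p₀ ∷ rest) → IsDecomposition (length rest) (lookup (p₀ ∷ rest))
  decomposition {p₀} {rest} inv all-covered r-on-path =
    (λ i → All.lookup long (∈-lookup i)) , (vertex-union , edge-union) , edge-disjoint , end-ordered
    where
    open Invariant inv
    ps = p₀ ∷ rest
    vertex-union : ∀ v → Σ (Fin (length ps)) λ i → PathVertex G (lookup ps i) v
    vertex-union v with all-covered v
    ... | inj₁ refl = Any.index r-on-path , Any.lookup-index r-on-path
    ... | inj₂ v-on-path = Any.index v-on-path , Any.lookup-index v-on-path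
    edge-union : ∀ x y → Adj x y → Σ (Fin (length ps)) λ i → PathEdge G (lookup ps i) x y
    edge-union x y x~y = Any.index e , Any.lookup-index e
      where e = every-edge-on-a-path inv all-covered x~y
    edge-disjoint : EdgeDisjoint G (length rest) (lookup ps)
    edge-disjoint i j i≢j x y e e′ with <-cmp i j
    ... | tri< i<j _ _ = proj₂ (AllPairs-lookup ordered i<j) x y e e′
    ... | tri≈ _ i≡j _ = i≢j i≡j
    ... | tri> _ _ j<i = proj₂ (AllPairs-lookup ordered j<i) x y e′ e
    end-ordered : EndOrdered G (length rest) (lookup ps)
    end-ordered i j i<j = proj₁ (AllPairs-lookup ordered i<j)

  root-on-path : ∀ {ps a} → Invariant ps → Covered ps a → ¬ a ≡ r → Any (λ p → PathVertex G p r) ps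
  root-on-path inv Ca a≢r with Invariant.reachable inv Ca
  ... | ε = ⊥-elim (a≢r refl)
  ... | e ◅ _ = Edge⇒covered-start e

  decompose : ∀ {a} → ¬ a ≡ r → Σ ℕ λ m → Σ (Fin (suc m) → Path G) (IsDecomposition m)
  decompose {a} a≢r with saturated
  ... | [] , inv , all-covered with root-on-path inv (all-covered a) a≢r
  ...   | ()
  decompose {a} a≢r | p₀ ∷ rest , inv , all-covered =
    length rest , lookup (p₀ ∷ rest) , decomposition inv all-covered (root-on-path inv (all-covered a) a≢r)

lemma3p1 : (N : ℕ) → 2 ≤ N → (G : SimpleGraph N) → IsTree G →
    (n : ℕ) → 1 ≤ n → Spindly G n →
    Σ ℕ λ m → Σ (Fin (suc m) → Path G) λ p →
      (∀ i → n ≤ pathLength G (p i)) × UnionIs G m p × EdgeDisjoint G m p × EndOrdered G m p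
lemma3p1 (suc (suc _)) (s≤s (s≤s _)) G (connected , acyclic) n _ spindly
  with spindly⇒root G n connected acyclic {zero} {suc zero} (λ ()) spindly
... | r , far-apart , far-from-root with another-vertex r
...   | _ , a≢r = Construction.decompose G connected acyclic n r far-apart far-from-root a≢r
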